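{- There is no finite set $\mathfrak{F}$ of graphs such that a graph is total threshold colorable if and only if it contains no subgraph isomorphic to a member of $\mathfrak{F}$. Likewise, there is no finite set $\mathfrak{F}$ of graphs such that a graph is total threshold colorable if and only if it contains no induced subgraph isomorphic to a member of $\mathfrak{F}$.
   Context: All graphs are finite, simple and undirected. A near-far-labeling of a graph $G$ is a pair $(N,F)$ with $N \subseteq E(G)$ and $F = E(G)\setminus N$. For integers $r \geq t$, an $(r,t)$-threshold-coloring of $G$ with respect to $(N,F)$ is a map $c: V(G) \to \{0,\ldots,r-1\}$ with $|c(u)-c(v)| \leq t$ for every $uv \in N$ and $|c(u)-c(v)| > t$ for every $uv \in F$. $G$ is total threshold colorable if there exist integers $r \geq t$ such that $G$ has an $(r,t)$-threshold-coloring with respect to every near-far-labeling. -}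

module Defs where

open import Data.Nat using (ℕ; _≤_; _<_; ∣_-_∣)
open import Data.Fin using (Fin)
open import Data.Bool using (Bool; true; false)
open import Data.Product using (Σ; ∃; _×_)
open import Data.List using (List)
open import Data.List.Relation.Unary.Any using (Any)
open import Relation.Binary.PropositionalEquality using (_≡_)
open import Relation.Nullary using (¬_)
open import Function.Definitions using (Injective)

record Graph : Set where
  field
    n     : ℕ
    adj   : Fin n → Fin n → Bool
    sym   : ∀ u v → adj u v ≡ adj v u
    irref : ∀ u → adj u u ≡ false

open Graph public

-- A near-far-labeling (N, F): a symmetric Boolean label on vertex pairs;
-- an edge uv is in N iff near u v ≡ true, otherwise it is in F.
-- (Values on non-edges are irrelevant.)
record Labeling (G : Graph) : Set where
  field
    near    : Fin (n G) → Fin (n G) → Bool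
    nearSym : ∀ u v → near u v ≡ near v u

open Labeling public

record ThresholdColoring (r t : ℕ) (G : Graph) (L : Labeling G) : Set where
  field
    col      : Fin (n G) → ℕ
    col<r    : ∀ v → col v < r
    nearOK   : ∀ u v → adj G u v ≡ true → near L u v ≡ true →
               ∣ col u - col v ∣ ≤ t
    farOK    : ∀ u v → adj G u v ≡ true → near L u v ≡ false →
               t < ∣ col u - col v ∣

TotalThresholdColorable : Graph → Set
TotalThresholdColorable G =
  Σ ℕ λ r → Σ ℕ λ t → t ≤ r × ((L : Labeling G) → ThresholdColoring r t G L)

SubgraphOf : Graph → Graph → Set
SubgraphOf H G =
  Σ (Fin (n H) → Fin (n G)) λ f → Injective _≡_ _≡_ f ×
    (∀ u v → adj H u v ≡ true → adj G (f u) (f v) ≡ true)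

InducedSubgraphOf : Graph → Graph → Set
InducedSubgraphOf H G =
  Σ (Fin (n H) → Fin (n G)) λ f → Injective _≡_ _≡_ f ×
    (∀ u v → adj G (f u) (f v) ≡ adj H u v)

ForbiddenSubgraphChar : List Graph → Set
ForbiddenSubgraphChar 𝔉 = ∀ G →
  (TotalThresholdColorable G → ¬ Any (λ H → SubgraphOf H G) 𝔉) ×
  (¬ Any (λ H → SubgraphOf H G) 𝔉 → TotalThresholdColorable G)

ForbiddenInducedSubgraphChar : List Graph → Set
ForbiddenInducedSubgraphChar 𝔉 = ∀ G →
  (TotalThresholdColorable G → ¬ Any (λ H → InducedSubgraphOf H G) 𝔉) ×
  (¬ Any (λ H → InducedSubgraphOf H G) 𝔉 → TotalThresholdColorable G)

-- Let G_k be the cycle of length k with every vertex doubled (both copies of a block are adjacent to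
-- both copies of each neighbouring block). Label an edge near iff it joins copies on the same side,
-- except across one chosen pair of consecutive blocks, where near means opposite sides. In any
-- threshold colouring the order of the two colours of a block then propagates along the cycle and is
-- reversed exactly once, so G_k is not total threshold colourable. Every graph on fewer than k
-- vertices that embeds into G_k misses a block, hence lies in the doubled path, and the doubled path
-- of any length is total threshold colourable: colour the blocks one after the other keeping the gap
-- between the two colours of a block between μ and 2t − μ, where the scale μ may shrink by a factor
-- 5 at each block, so t = 5^N suffices. Where the two new colours go is a finite table, and its
-- correctness is a system of linear inequalities in t, μ and the current gap, decided by comparing
-- coefficients. A finite family of forbidden (induced) subgraphs would have to contain a subgraph
-- of G_k for k larger than all its members, and that member would then be colourable.
module Submission where

open import Defs
open import Data.List using (List)
open import Data.Product using (_×_; ∃)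
open import Relation.Nullary using (¬_)

open import Data.Bool using (Bool; true; false; not; T; _∧_; _∨_; _xor_; if_then_else_)
open import Data.Bool.Properties
  using (T-≡; T-∧; T-∨; ∨-comm; ∨-zeroʳ; ∧-zeroʳ; xor-comm; xor-same; not-involutive)
open import Data.Empty using (⊥; ⊥-elim)
open import Data.Fin as Fin using (Fin; toℕ; fromℕ<; _↑ˡ_; _↑ʳ_; splitAt)
open import Data.Fin.Properties
  using (any?; all?; ¬∀⟶∃¬; pigeonhole; toℕ-injective; toℕ-fromℕ<; toℕ<n;
         splitAt-↑ˡ; splitAt-↑ʳ; splitAt⁻¹-↑ˡ; splitAt⁻¹-↑ʳ)
  renaming (_≟_ to _≟ᶠ_)
open import Data.List using (map)
open import Data.List.Extrema.Nat using (max; xs≤max)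
open import Data.List.Membership.Propositional.Properties using (∈-lookup)
open import Data.List.Relation.Unary.All using (All; lookupAny)
open import Data.List.Relation.Unary.All.Properties using (map⁻)
open import Data.List.Relation.Unary.Any as Any using (Any)
open import Data.Nat
open import Data.Nat.DivMod using (m%n<n; m<n⇒m%n≡m; [m+n]%n≡m%n)
open import Data.Nat.Properties
open import Data.Nat.Tactic.RingSolver using (solve-∀)
open import Data.Product using (∃-syntax; _,_; proj₁; proj₂)
open import Data.Sum using (_⊎_; inj₁; inj₂; [_,_]′)
open import Function.Base using (id; _∘_)
open import Function.Bundles using (Equivalence)
open import Function.Definitions using (Injective)
open import Relation.Binary.Definitions using (tri<; tri≈; tri>)
open import Relation.Binary.PropositionalEquality hiding (sym)
import Relation.Binary.PropositionalEquality as ≡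
open import Relation.Nullary using (yes; no)

-- Linear forms

-- Without eta, ⟦ X ⟧ stays a stuck application for a variable X, so it can be inferred from goals.
record Lin : Set where
  no-eta-equality
  pattern
  constructor lin
  field
    con cx cy cz : ℕ

⟦_⟧ : Lin → ℕ → ℕ → ℕ → ℕ
⟦ lin c a b d ⟧ x y z = a * x + b * y + d * z + c

const : ℕ → Lin
const c = lin c 0 0 0

1̂ x̂ ŷ ẑ : Lin
1̂ = const 1
x̂ = lin 0 1 0 0
ŷ = lin 0 0 1 0
ẑ = lin 0 0 0 1

infixl 6 _⊕_
infixr 7 _⊛_

_⊕_ : Lin → Lin → Lin
lin c a b d ⊕ lin c′ a′ b′ d′ = lin (c + c′) (a + a′) (b + b′) (d + d′)

_⊛_ : ℕ → Lin → Lin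
m ⊛ lin c a b d = lin (m * c) (m * a) (m * b) (m * d)

_∘ₗ_,_,_ : Lin → Lin → Lin → Lin → Lin
lin c a b d ∘ₗ σx , σy , σz = a ⊛ σx ⊕ b ⊛ σy ⊕ d ⊛ σz ⊕ const c

⟦⊕⟧ : ∀ l m x y z → ⟦ l ⊕ m ⟧ x y z ≡ ⟦ l ⟧ x y z + ⟦ m ⟧ x y z
⟦⊕⟧ (lin c a b d) (lin c′ a′ b′ d′) = additive c a b d c′ a′ b′ d′
  where
  additive : ∀ c a b d c′ a′ b′ d′ x y z →
    (a + a′) * x + (b + b′) * y + (d + d′) * z + (c + c′)
      ≡ (a * x + b * y + d * z + c) + (a′ * x + b′ * y + d′ * z + c′)
  additive = solve-∀

⟦⊛⟧ : ∀ m l x y z → ⟦ m ⊛ l ⟧ x y z ≡ m * ⟦ l ⟧ x y z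
⟦⊛⟧ m (lin c a b d) = homogeneous m c a b d
  where
  homogeneous : ∀ m c a b d x y z →
    m * a * x + m * b * y + m * d * z + m * c ≡ m * (a * x + b * y + d * z + c)
  homogeneous = solve-∀

⟦x̂⟧ : ∀ x y z → ⟦ x̂ ⟧ x y z ≡ x
⟦x̂⟧ = unit
  where
  unit : ∀ x y z → 1 * x + 0 * y + 0 * z + 0 ≡ x
  unit = solve-∀

⟦ŷ⟧ : ∀ x y z → ⟦ ŷ ⟧ x y z ≡ y
⟦ŷ⟧ = unit
  where
  unit : ∀ x y z → 0 * x + 1 * y + 0 * z + 0 ≡ y
  unit = solve-∀

⟦ẑ⟧ : ∀ x y z → ⟦ ẑ ⟧ x y z ≡ z
⟦ẑ⟧ = unit
  where
  unit : ∀ x y z → 0 * x + 0 * y + 1 * z + 0 ≡ z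
  unit = solve-∀

⟦∘ₗ⟧ : ∀ l σx σy σz x y z →
  ⟦ l ∘ₗ σx , σy , σz ⟧ x y z ≡ ⟦ l ⟧ (⟦ σx ⟧ x y z) (⟦ σy ⟧ x y z) (⟦ σz ⟧ x y z)
⟦∘ₗ⟧ (lin c a b d) σx σy σz x y z = begin
  ⟪ a ⊛ σx ⊕ b ⊛ σy ⊕ d ⊛ σz ⊕ const c ⟫
    ≡⟨ ⟦⊕⟧ (a ⊛ σx ⊕ b ⊛ σy ⊕ d ⊛ σz) (const c) x y z ⟩
  ⟪ a ⊛ σx ⊕ b ⊛ σy ⊕ d ⊛ σz ⟫ + c
    ≡⟨ cong (_+ c) (⟦⊕⟧ (a ⊛ σx ⊕ b ⊛ σy) (d ⊛ σz) x y z) ⟩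
  ⟪ a ⊛ σx ⊕ b ⊛ σy ⟫ + ⟪ d ⊛ σz ⟫ + c
    ≡⟨ cong (λ e → e + ⟪ d ⊛ σz ⟫ + c) (⟦⊕⟧ (a ⊛ σx) (b ⊛ σy) x y z) ⟩
  ⟪ a ⊛ σx ⟫ + ⟪ b ⊛ σy ⟫ + ⟪ d ⊛ σz ⟫ + c
    ≡⟨ cong (_+ c) (cong₂ _+_ (cong₂ _+_ (⟦⊛⟧ a σx x y z) (⟦⊛⟧ b σy x y z)) (⟦⊛⟧ d σz x y z)) ⟩
  a * ⟪ σx ⟫ + b * ⟪ σy ⟫ + d * ⟪ σz ⟫ + c ∎
  where
  open ≡-Reasoning
  ⟪_⟫ : Lin → ℕ
  ⟪ l ⟫ = ⟦ l ⟧ x y z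

_≤ᵇₗ_ : Lin → Lin → Bool
lin c a b d ≤ᵇₗ lin c′ a′ b′ d′ = (c ≤ᵇ c′) ∧ (a ≤ᵇ a′) ∧ (b ≤ᵇ b′) ∧ (d ≤ᵇ d′)

≤ᵇₗ-sound : ∀ l m → T (l ≤ᵇₗ m) → ∀ x y z → ⟦ l ⟧ x y z ≤ ⟦ m ⟧ x y z
≤ᵇₗ-sound (lin c a b d) (lin c′ a′ b′ d′) h x y z with Equivalence.to T-∧ h
... | c≤ , h′ with Equivalence.to T-∧ h′
...   | a≤ , h″ with Equivalence.to T-∧ h″
...     | b≤ , d≤ =
  +-mono-≤ (+-mono-≤ (+-mono-≤ (*-monoˡ-≤ x (≤ᵇ⇒≤ a a′ a≤)) (*-monoˡ-≤ y (≤ᵇ⇒≤ b b′ b≤)))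
                     (*-monoˡ-≤ z (≤ᵇ⇒≤ d d′ d≤)))
           (≤ᵇ⇒≤ c c′ c≤)

infix  4 _≼_
infixr 3 _∧ᶜ_
infixr 2 _∨ᶜ_

data Constraint : Set where
  _≼_ : Lin → Lin → Constraint
  _∧ᶜ_ _∨ᶜ_ : Constraint → Constraint → Constraint

Holds : Constraint → ℕ → ℕ → ℕ → Set
Holds (l ≼ m)  x y z = ⟦ l ⟧ x y z ≤ ⟦ m ⟧ x y z
Holds (φ ∧ᶜ ψ) x y z = Holds φ x y z × Holds ψ x y z
Holds (φ ∨ᶜ ψ) x y z = Holds φ x y z ⊎ Holds ψ x y z

Holds-cong : ∀ φ {x x′ y y′ z z′} → x ≡ x′ → y ≡ y′ → z ≡ z′ → Holds φ x y z → Holds φ x′ y′ z′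
Holds-cong φ refl refl refl h = h

-- Checks φ at (σx, σy, σz) for all values of the variables by comparing coefficients; for a single
-- inequality this is exact, since the variables range over all of ℕ.
checkAt : Lin → Lin → Lin → Constraint → Bool
checkAt σx σy σz (l ≼ m)  = (l ∘ₗ σx , σy , σz) ≤ᵇₗ (m ∘ₗ σx , σy , σz)
checkAt σx σy σz (φ ∧ᶜ ψ) = checkAt σx σy σz φ ∧ checkAt σx σy σz ψ
checkAt σx σy σz (φ ∨ᶜ ψ) = checkAt σx σy σz φ ∨ checkAt σx σy σz ψ

checkAt-sound : ∀ σx σy σz φ → T (checkAt σx σy σz φ) →
  ∀ u v w → Holds φ (⟦ σx ⟧ u v w) (⟦ σy ⟧ u v w) (⟦ σz ⟧ u v w)
checkAt-sound σx σy σz (l ≼ m) h u v w =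
  subst₂ _≤_ (⟦∘ₗ⟧ l σx σy σz u v w) (⟦∘ₗ⟧ m σx σy σz u v w)
    (≤ᵇₗ-sound (l ∘ₗ σx , σy , σz) (m ∘ₗ σx , σy , σz) h u v w)
checkAt-sound σx σy σz (φ ∧ᶜ ψ) h u v w with Equivalence.to T-∧ h
... | hφ , hψ = checkAt-sound σx σy σz φ hφ u v w , checkAt-sound σx σy σz ψ hψ u v w
checkAt-sound σx σy σz (φ ∨ᶜ ψ) h u v w with Equivalence.to T-∨ h
... | inj₁ hφ = inj₁ (checkAt-sound σx σy σz φ hφ u v w)
... | inj₂ hψ = inj₂ (checkAt-sound σx σy σz ψ hψ u v w)

-- Threshold distances

Respects : ℕ → Bool → ℕ → Set
Respects t true  d = d ≤ t
Respects t false d = t < d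

Spread : ℕ → ℕ → ℕ → ℕ → Set
Spread t μ a b = μ ≤ ∣ a - b ∣ × ∣ a - b ∣ + μ ≤ 2 * t

∣-∣≤ : ∀ {a b t} → a ≤ b + t → b ≤ a + t → ∣ a - b ∣ ≤ t
∣-∣≤ {a} {b} a≤b+t b≤a+t with ≤-total a b
... | inj₁ a≤b = subst (_≤ _) (≡.sym (m≤n⇒∣m-n∣≡n∸m a≤b)) (m≤n+o⇒m∸n≤o b a b≤a+t)
... | inj₂ b≤a = subst (_≤ _) (≡.sym (m≤n⇒∣n-m∣≡n∸m b≤a)) (m≤n+o⇒m∸n≤o a b a≤b+t)

≤∣-∣ : ∀ {a b d} → b + d ≤ a → d ≤ ∣ a - b ∣
≤∣-∣ {a} {b} {d} b+d≤a =
  ≤-trans (subst (_≤ a ∸ b) (m+n∸m≡n b d) (∸-monoˡ-≤ b b+d≤a)) (m∸n≤∣m-n∣ a b)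

≤+∣-∣ : ∀ {a b t} → ∣ a - b ∣ ≤ t → a ≤ b + t
≤+∣-∣ {a} {b} d≤t = ≤-trans (m≤n+∣m-n∣ a b) (+-monoʳ-≤ b d≤t)

+<∣-∣ : ∀ {a b t} → b ≤ a → t < ∣ a - b ∣ → b + t < a
+<∣-∣ {a} {b} {t} b≤a t<d =
  subst (b + t <_) (trans (cong (b +_) (m≤n⇒∣n-m∣≡n∸m b≤a)) (m+[n∸m]≡n b≤a)) (+-monoʳ-< b t<d)

mkSpread : ∀ {t μ a b} → a + μ ≤ b → b + μ ≤ a + 2 * t → Spread t μ a b
mkSpread {t} {μ} {a} {b} a+μ≤b b+μ≤a+2t =
  subst (μ ≤_) (∣-∣-comm b a) (≤∣-∣ a+μ≤b) ,
  subst (λ d → d + μ ≤ 2 * t) (≡.sym (m≤n⇒∣m-n∣≡n∸m a≤b))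
    (subst (_≤ 2 * t) (+-∸-comm μ a≤b) (m≤n+o⇒m∸n≤o (b + μ) a b+μ≤a+2t))
  where
  a≤b : a ≤ b
  a≤b = ≤-trans (m≤m+n a μ) a+μ≤b

Spread-comm : ∀ t μ a b → Spread t μ a b → Spread t μ b a
Spread-comm t μ a b = subst (λ d → μ ≤ d × d + μ ≤ 2 * t) (∣-∣-comm a b)

Spread-shift : ∀ t μ o a b → Spread t μ a b → Spread t μ (o + a) (o + b)
Spread-shift t μ o a b = subst (λ d → μ ≤ d × d + μ ≤ 2 * t) (≡.sym (∣m+n-m+o∣≡∣n-o∣ o a b))

order-transfer : ∀ {a b a′ b′ t} → a < b → ∣ a′ - a ∣ ≤ t → ∣ b′ - b ∣ ≤ t → t < ∣ b′ - a ∣ → a′ < b′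
order-transfer {a} {b} {a′} {b′} a<b a′≈a b′≈b b′≉a with ≤-total b′ a
... | inj₁ b′≤a = ⊥-elim (<-asym a<b (≤-<-trans (≤+∣-∣ (subst (_≤ _) (∣-∣-comm b′ b) b′≈b))
                                                (+<∣-∣ b′≤a (subst (_ <_) (∣-∣-comm b′ a) b′≉a))))
... | inj₂ a≤b′ = ≤-<-trans (≤+∣-∣ a′≈a) (+<∣-∣ a≤b′ b′≉a)

-- Placing the next block

t̂ μ̂ ĝ : Lin
t̂ = x̂
μ̂ = ŷ
ĝ = ẑ

-- Coordinates are relative to lo − (t + 2μ) when the previous block has colours lo ≤ lo + g.
old : Bool → Lin
old true  = t̂ ⊕ 2 ⊛ μ̂
old false = t̂ ⊕ 2 ⊛ μ̂ ⊕ ĝ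

-- Each combination of near/far to the two old colours has its own region; the two new vertices
-- sit μ apart when they fall in the same one. A vertex far from both goes to the right exactly
-- when the other new vertex is far from the lower and near the higher old colour.
slot : (nearLow nearHigh otherFarNear second : Bool) → Lin
slot true  true  _     false = 2 ⊛ μ̂ ⊕ ĝ
slot true  true  _     true  = 3 ⊛ μ̂ ⊕ ĝ
slot true  false _     false = μ̂ ⊕ ĝ
slot true  false _     true  = ĝ
slot false true  _     false = 2 ⊛ t̂ ⊕ 3 ⊛ μ̂
slot false true  _     true  = 2 ⊛ t̂ ⊕ 4 ⊛ μ̂
slot false false true  false = 2 ⊛ t̂ ⊕ 3 ⊛ μ̂ ⊕ ĝ
slot false false true  true  = 2 ⊛ t̂ ⊕ 4 ⊛ μ̂ ⊕ ĝ
slot false false false false = μ̂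
slot false false false true  = const 0

farNear : Bool → Bool → Bool
farNear false true = true
farNear _     _    = false

place : (Bool → Bool → Bool) → Bool → Lin
place ℓ s = slot (ℓ s true) (ℓ s false) (farNear (ℓ (not s) true) (ℓ (not s) false)) (not s)

Respectsᶜ : Bool → Lin → Lin → Constraint
Respectsᶜ true  X Y = X ≼ Y ⊕ t̂ ∧ᶜ Y ≼ X ⊕ t̂
Respectsᶜ false X Y = 1̂ ⊕ Y ⊕ t̂ ≼ X ∨ᶜ 1̂ ⊕ X ⊕ t̂ ≼ Y

Spreadᶜ : Lin → Lin → Constraint
Spreadᶜ X Y = (X ⊕ μ̂ ≼ Y ∧ᶜ Y ⊕ μ̂ ≼ X ⊕ 2 ⊛ t̂) ∨ᶜ (Y ⊕ μ̂ ≼ X ∧ᶜ X ⊕ μ̂ ≼ Y ⊕ 2 ⊛ t̂)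

Nearbyᶜ : Lin → Constraint
Nearbyᶜ X = old true ≼ X ⊕ 3 ⊛ t̂ ∧ᶜ X ≼ old false ⊕ 3 ⊛ t̂

both : (Bool → Constraint) → Constraint
both φ = φ true ∧ᶜ φ false

both-holds : ∀ φ {x y z} → Holds (both φ) x y z → ∀ b → Holds (φ b) x y z
both-holds φ (h , _) true  = h
both-holds φ (_ , h) false = h

EdgeOK : (Bool → Bool → Bool) → Bool → Bool → Constraint
EdgeOK ℓ s′ s = Respectsᶜ (ℓ s′ s) (place ℓ s′) (old s)

PlacedOK : (Bool → Bool → Bool) → Bool → Constraint
PlacedOK ℓ s′ = Nearbyᶜ (place ℓ s′) ∧ᶜ both (EdgeOK ℓ s′)

Valid : (Bool → Bool → Bool) → Constraint
Valid ℓ = Spreadᶜ (place ℓ true) (place ℓ false) ∧ᶜ both (PlacedOK ℓ)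

module AtPoint (t μ g : ℕ) where

  ⟪_⟫ : Lin → ℕ
  ⟪ X ⟫ = ⟦ X ⟧ t μ g

  ⟪+t⟫ : ∀ X → ⟪ X ⊕ t̂ ⟫ ≡ ⟪ X ⟫ + t
  ⟪+t⟫ X = trans (⟦⊕⟧ X t̂ t μ g) (cong (⟪ X ⟫ +_) (⟦x̂⟧ t μ g))

  ⟪+μ⟫ : ∀ X → ⟪ X ⊕ μ̂ ⟫ ≡ ⟪ X ⟫ + μ
  ⟪+μ⟫ X = trans (⟦⊕⟧ X μ̂ t μ g) (cong (⟪ X ⟫ +_) (⟦ŷ⟧ t μ g))

  ⟪+mt⟫ : ∀ m X → ⟪ X ⊕ m ⊛ t̂ ⟫ ≡ ⟪ X ⟫ + m * t
  ⟪+mt⟫ m X = trans (⟦⊕⟧ X (m ⊛ t̂) t μ g)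
    (cong (⟪ X ⟫ +_) (trans (⟦⊛⟧ m t̂ t μ g) (cong (m *_) (⟦x̂⟧ t μ g))))

  ⟪old-low⟫ : ⟪ old true ⟫ ≡ t + 2 * μ
  ⟪old-low⟫ = trans (⟦⊕⟧ t̂ (2 ⊛ μ̂) t μ g)
    (cong₂ _+_ (⟦x̂⟧ t μ g) (trans (⟦⊛⟧ 2 μ̂ t μ g) (cong (2 *_) (⟦ŷ⟧ t μ g))))

  ⟪old-high⟫ : ⟪ old false ⟫ ≡ t + 2 * μ + g
  ⟪old-high⟫ = trans (⟦⊕⟧ (old true) ĝ t μ g) (cong₂ _+_ ⟪old-low⟫ (⟦ẑ⟧ t μ g))

  far : ∀ X Y → ⟪ 1̂ ⊕ Y ⊕ t̂ ⟫ ≤ ⟪ X ⟫ → t < ∣ ⟪ X ⟫ - ⟪ Y ⟫ ∣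
  far X Y = ≤∣-∣ ∘ subst (_≤ ⟪ X ⟫) (trans (⟪+t⟫ (1̂ ⊕ Y)) (trans (cong (_+ t) (⟦⊕⟧ 1̂ Y t μ g))
                                                             (≡.sym (+-suc ⟪ Y ⟫ t))))

  respects : ∀ b X Y → Holds (Respectsᶜ b X Y) t μ g → Respects t b ∣ ⟪ X ⟫ - ⟪ Y ⟫ ∣
  respects true X Y (X≤Y+t , Y≤X+t) =
    ∣-∣≤ (subst (_ ≤_) (⟪+t⟫ Y) X≤Y+t) (subst (_ ≤_) (⟪+t⟫ X) Y≤X+t)
  respects false X Y (inj₁ Y+t<X) = far X Y Y+t<X
  respects false X Y (inj₂ X+t<Y) = subst (t <_) (∣-∣-comm ⟪ Y ⟫ ⟪ X ⟫) (far Y X X+t<Y)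

  spreads : ∀ X Y → Holds (Spreadᶜ X Y) t μ g → Spread t μ ⟪ X ⟫ ⟪ Y ⟫
  spreads X Y (inj₁ (X+μ≤Y , Y+μ≤X+2t)) =
    mkSpread {t} (subst (_≤ _) (⟪+μ⟫ X) X+μ≤Y) (subst₂ _≤_ (⟪+μ⟫ Y) (⟪+mt⟫ 2 X) Y+μ≤X+2t)
  spreads X Y (inj₂ (Y+μ≤X , X+μ≤Y+2t)) = Spread-comm t μ ⟪ Y ⟫ ⟪ X ⟫
    (mkSpread {t} (subst (_≤ _) (⟪+μ⟫ Y) Y+μ≤X) (subst₂ _≤_ (⟪+μ⟫ X) (⟪+mt⟫ 2 Y) X+μ≤Y+2t))

  nearby : ∀ X → Holds (Nearbyᶜ X) t μ g →
    ⟪ old true ⟫ ≤ ⟪ X ⟫ + 3 * t × ⟪ X ⟫ ≤ ⟪ old false ⟫ + 3 * t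
  nearby X (low≤X+3t , X≤high+3t) =
    subst (_ ≤_) (⟪+mt⟫ 3 X) low≤X+3t , subst (⟪ X ⟫ ≤_) (⟪+mt⟫ 3 (old false)) X≤high+3t

-- With μ = 1 + u, the admissible points (t, μ, g) are t = 5μ + v + w and either g = 5μ + v
-- (narrow, g ≤ t) or g = t + v (wide, g ≥ t).
μ̃ t̃ g̃ₙ g̃ʷ : Lin
μ̃  = 1̂ ⊕ x̂
t̃  = 5 ⊛ μ̃ ⊕ ŷ ⊕ ẑ
g̃ₙ = 5 ⊛ μ̃ ⊕ ŷ
g̃ʷ = t̃ ⊕ ŷ

data Shape : ℕ → ℕ → ℕ → Set where
  narrow : ∀ u v w → Shape (5 * suc u + v + w) (suc u) (5 * suc u + v)
  wide   : ∀ u v w → Shape (5 * suc u + v + w) (suc u) (5 * suc u + v + w + v)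

shape : ∀ {t μ g} → 1 ≤ μ → 5 * μ ≤ g → g + 5 * μ ≤ 2 * t → Shape t μ g
shape {t} {suc u} {g} (s≤s z≤n) 5μ≤g g+5μ≤2t with ≤-total g t
... | inj₁ g≤t with m≤n⇒∃[o]m+o≡n 5μ≤g
...   | v , refl with m≤n⇒∃[o]m+o≡n g≤t
...     | w , refl = narrow u v w
shape {t} {suc u} {g} (s≤s z≤n) 5μ≤g g+5μ≤2t | inj₂ t≤g with m≤n⇒∃[o]m+o≡n t≤g
...   | v , refl with m≤n⇒∃[o]m+o≡n 5μ+v≤t
  where
  5μ+v≤t : 5 * suc u + v ≤ t
  5μ+v≤t = +-cancelˡ-≤ t _ _ (subst₂ _≤_ rearrange (cong (t +_) (+-identityʳ t)) g+5μ≤2t)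
    where
    rearrange : t + v + 5 * suc u ≡ t + (5 * suc u + v)
    rearrange = trans (+-assoc t v (5 * suc u)) (cong (t +_) (+-comm v (5 * suc u)))
...     | w , refl = wide u v w

module _ (u v w : ℕ) where

  μ̃-value : ⟦ μ̃ ⟧ u v w ≡ suc u
  μ̃-value = trans (⟦⊕⟧ 1̂ x̂ u v w) (cong suc (⟦x̂⟧ u v w))

  g̃ₙ-value : ⟦ g̃ₙ ⟧ u v w ≡ 5 * suc u + v
  g̃ₙ-value = trans (⟦⊕⟧ (5 ⊛ μ̃) ŷ u v w)
    (cong₂ _+_ (trans (⟦⊛⟧ 5 μ̃ u v w) (cong (5 *_) μ̃-value)) (⟦ŷ⟧ u v w))

  t̃-value : ⟦ t̃ ⟧ u v w ≡ 5 * suc u + v + w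
  t̃-value = trans (⟦⊕⟧ g̃ₙ ẑ u v w) (cong₂ _+_ g̃ₙ-value (⟦ẑ⟧ u v w))

  g̃ʷ-value : ⟦ g̃ʷ ⟧ u v w ≡ 5 * suc u + v + w + v
  g̃ʷ-value = trans (⟦⊕⟧ t̃ ŷ u v w) (cong₂ _+_ t̃-value (⟦ŷ⟧ u v w))

labelling : Bool → Bool → Bool → Bool → Bool → Bool → Bool
labelling a b c d true  true  = a
labelling a b c d true  false = b
labelling a b c d false true  = c
labelling a b c d false false = d

forAll : (Bool → Bool) → Bool
forAll f = f true ∧ f false

forAll-elim : ∀ f → T (forAll f) → ∀ b → T (f b)
forAll-elim f h true  = proj₁ (Equivalence.to T-∧ h)
forAll-elim f h false = proj₂ (Equivalence.to T-∧ h)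

allValid : Lin → Lin → Lin → Bool
allValid σx σy σz = forAll λ a → forAll λ b → forAll λ c → forAll λ d →
  checkAt σx σy σz (Valid (labelling a b c d))

forAll⁴-elim : ∀ (P : Bool → Bool → Bool → Bool → Bool) →
  T (forAll λ a → forAll λ b → forAll λ c → forAll (P a b c)) → ∀ a b c d → T (P a b c d)
forAll⁴-elim P h a b c = forAll-elim (P a b c)
  (forAll-elim (λ c → forAll (P a b c))
    (forAll-elim (λ b → forAll λ c → forAll (P a b c))
      (forAll-elim (λ a → forAll λ b → forAll λ c → forAll (P a b c)) h a) b) c)

allValid-sound : ∀ σx σy σz → T (allValid σx σy σz) → ∀ ℓ → T (checkAt σx σy σz (Valid ℓ))
allValid-sound σx σy σz h ℓ = forAll⁴-elim (λ a b c d → checkAt σx σy σz (Valid (labelling a b c d))) h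
  (ℓ true true) (ℓ true false) (ℓ false true) (ℓ false false)

-- The entire case analysis of the placement, for all sixteen labellings, by evaluation.
allValid-narrow : T (allValid t̃ μ̃ g̃ₙ)
allValid-narrow = _

allValid-wide : T (allValid t̃ μ̃ g̃ʷ)
allValid-wide = _

valid-narrow : ∀ u v w ℓ → Holds (Valid ℓ) (5 * suc u + v + w) (suc u) (5 * suc u + v)
valid-narrow u v w ℓ = Holds-cong (Valid ℓ) (t̃-value u v w) (μ̃-value u v w) (g̃ₙ-value u v w)
  (checkAt-sound t̃ μ̃ g̃ₙ (Valid ℓ) (allValid-sound t̃ μ̃ g̃ₙ allValid-narrow ℓ) u v w)

valid-wide : ∀ u v w ℓ → Holds (Valid ℓ) (5 * suc u + v + w) (suc u) (5 * suc u + v + w + v)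
valid-wide u v w ℓ = Holds-cong (Valid ℓ) (t̃-value u v w) (μ̃-value u v w) (g̃ʷ-value u v w)
  (checkAt-sound t̃ μ̃ g̃ʷ (Valid ℓ) (allValid-sound t̃ μ̃ g̃ʷ allValid-wide ℓ) u v w)

valid : ∀ {t μ g} → 1 ≤ μ → 5 * μ ≤ g → g + 5 * μ ≤ 2 * t → ∀ ℓ → Holds (Valid ℓ) t μ g
valid 1≤μ 5μ≤g g+5μ≤2t = validAt (shape 1≤μ 5μ≤g g+5μ≤2t)
  where
  validAt : ∀ {t μ g} → Shape t μ g → ∀ ℓ → Holds (Valid ℓ) t μ g
  validAt (narrow u v w) = valid-narrow u v w
  validAt (wide u v w)   = valid-wide u v w

Pair : Set
Pair = Bool → ℕ

record Extends (t μ : ℕ) (z : Pair) (ℓ : Bool → Bool → Bool) (x : Pair) : Set where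
  field
    spread   : Spread t μ (x true) (x false)
    respects : ∀ s′ s → Respects t (ℓ s′ s) ∣ x s′ - z s ∣
    above    : ∀ s′ → ∃[ s ] z s ≤ x s′ + 3 * t
    below    : ∀ s′ → ∃[ s ] x s′ ≤ z s + 3 * t

extendOrdered : ℕ → ℕ → Pair → (Bool → Bool → Bool) → Pair
extendOrdered t μ z ℓ s = z true ∸ (t + 2 * μ) + ⟦ place ℓ s ⟧ t μ (z false ∸ z true)

extendOrdered-extends : ∀ {t μ z} ℓ → z true ≤ z false → 1 ≤ μ → Spread t (5 * μ) (z true) (z false) →
  t + 2 * μ ≤ z true → Extends t μ z ℓ (extendOrdered t μ z ℓ)
extendOrdered-extends {t} {μ} {z} ℓ lo≤hi 1≤μ (5μ≤g , g+5μ≤2t) t+2μ≤lo = record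
  { spread   = Spread-shift t μ O _ _ (spreads (place ℓ true) (place ℓ false) (proj₁ holds))
  ; respects = λ s′ s → subst (Respects t (ℓ s′ s)) (shift s′ s)
                 (respects (ℓ s′ s) (place ℓ s′) (old s) (edgeOK s′ s))
  ; above    = λ s′ → true , lowest s′
  ; below    = λ s′ → false , highest s′
  }
  where
  g = z false ∸ z true
  O = z true ∸ (t + 2 * μ)
  open AtPoint t μ g

  ∣lo-hi∣≡g : ∣ z true - z false ∣ ≡ g
  ∣lo-hi∣≡g = m≤n⇒∣m-n∣≡n∸m lo≤hi

  holds : Holds (Valid ℓ) t μ g
  holds = valid 1≤μ (subst (5 * μ ≤_) ∣lo-hi∣≡g 5μ≤g)
                    (subst (λ d → d + 5 * μ ≤ 2 * t) ∣lo-hi∣≡g g+5μ≤2t) ℓ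

  placedOK : ∀ s′ → Holds (PlacedOK ℓ s′) t μ g
  placedOK = both-holds (PlacedOK ℓ) (proj₂ holds)

  edgeOK : ∀ s′ s → Holds (EdgeOK ℓ s′ s) t μ g
  edgeOK s′ = both-holds (EdgeOK ℓ s′) (proj₂ (placedOK s′))

  based : ∀ s → O + ⟪ old s ⟫ ≡ z s
  based true  = trans (cong (O +_) ⟪old-low⟫) (m∸n+n≡m t+2μ≤lo)
  based false = begin
    O + ⟪ old false ⟫       ≡⟨ cong (O +_) ⟪old-high⟫ ⟩
    O + (t + 2 * μ + g)    ≡⟨ +-assoc O (t + 2 * μ) g ⟨
    O + (t + 2 * μ) + g    ≡⟨ cong (_+ g) (m∸n+n≡m t+2μ≤lo) ⟩
    z true + g             ≡⟨ m+[n∸m]≡n lo≤hi ⟩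
    z false                ∎
    where open ≡-Reasoning

  lowest : ∀ s′ → z true ≤ extendOrdered t μ z ℓ s′ + 3 * t
  lowest s′ = begin
    z true                         ≡⟨ based true ⟨
    O + ⟪ old true ⟫               ≤⟨ +-monoʳ-≤ O (proj₁ (nearby (place ℓ s′) (proj₁ (placedOK s′)))) ⟩
    O + (⟪ place ℓ s′ ⟫ + 3 * t)   ≡⟨ +-assoc O ⟪ place ℓ s′ ⟫ (3 * t) ⟨
    O + ⟪ place ℓ s′ ⟫ + 3 * t     ∎
    where open ≤-Reasoning

  highest : ∀ s′ → extendOrdered t μ z ℓ s′ ≤ z false + 3 * t
  highest s′ = begin
    O + ⟪ place ℓ s′ ⟫             ≤⟨ +-monoʳ-≤ O (proj₂ (nearby (place ℓ s′) (proj₁ (placedOK s′)))) ⟩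
    O + (⟪ old false ⟫ + 3 * t)    ≡⟨ +-assoc O ⟪ old false ⟫ (3 * t) ⟨
    O + ⟪ old false ⟫ + 3 * t      ≡⟨ cong (_+ 3 * t) (based false) ⟩
    z false + 3 * t                ∎
    where open ≤-Reasoning

  shift : ∀ s′ s → ∣ ⟪ place ℓ s′ ⟫ - ⟪ old s ⟫ ∣ ≡ ∣ extendOrdered t μ z ℓ s′ - z s ∣
  shift s′ s = trans (≡.sym (∣m+n-m+o∣≡∣n-o∣ O _ _)) (cong (λ y → ∣ O + ⟪ place ℓ s′ ⟫ - y ∣) (based s))

extends-swap : ∀ {t μ z ℓ x} → Extends t μ (z ∘ not) (λ s′ s → ℓ s′ (not s)) x → Extends t μ z ℓ x
extends-swap {t} {μ} {z} {ℓ} {x} e = record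
  { spread   = spread
  ; respects = λ s′ s → subst (λ r → Respects t (ℓ s′ r) ∣ x s′ - z r ∣) (not-involutive s)
                          (respects s′ (not s))
  ; above    = λ s′ → not (proj₁ (above s′)) , proj₂ (above s′)
  ; below    = λ s′ → not (proj₁ (below s′)) , proj₂ (below s′)
  }
  where open Extends e

extend : ℕ → ℕ → Pair → (Bool → Bool → Bool) → Pair
extend t μ z ℓ = if z true ≤ᵇ z false
  then extendOrdered t μ z ℓ
  else extendOrdered t μ (z ∘ not) (λ s′ s → ℓ s′ (not s))

extend-extends : ∀ {t μ z} ℓ → 1 ≤ μ → Spread t (5 * μ) (z true) (z false) →
  (∀ s → t + 2 * μ ≤ z s) → Extends t μ z ℓ (extend t μ z ℓ)
extend-extends {t} {μ} {z} ℓ 1≤μ spread t+2μ≤ with z true ≤ᵇ z false in ordered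
... | true  = extendOrdered-extends ℓ (≤ᵇ⇒≤ (z true) (z false) (Equivalence.from T-≡ ordered))
                1≤μ spread (t+2μ≤ true)
... | false = extends-swap (extendOrdered-extends _ hi≤lo 1≤μ
                (Spread-comm t (5 * μ) (z true) (z false) spread) (t+2μ≤ false))
  where
  hi≤lo : z false ≤ z true
  hi≤lo = ≰⇒≥ (λ lo≤hi → subst T ordered (≤⇒≤ᵇ lo≤hi))

-- Colouring a doubled path

threshold : ℕ → ℕ
threshold N = 5 ^ N

range : ℕ → ℕ
range N = suc (3 * threshold N * N + threshold N + 3 * threshold N * N)

threshold≤range : ∀ N → threshold N ≤ range N
threshold≤range N = ≤-trans (m≤n+m _ (3 * threshold N * N)) (≤-trans (m≤m+n _ _) (n≤1+n _))

-- ℓ e s′ s is the label of the edge between side s′ of block e + 1 and side s of block e.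
module PathColouring (N : ℕ) (ℓ : ℕ → Bool → Bool → Bool) where

  private
    t = threshold N
    base = 3 * t * N

  scale : ℕ → ℕ
  scale e = 5 ^ (N ∸ e)

  scale-suc : ∀ {e} → e < N → scale e ≡ 5 * scale (suc e)
  scale-suc e<N = cong (5 ^_) (+-∸-assoc 1 e<N)

  1≤scale : ∀ e → 1 ≤ scale e
  1≤scale e = m^n>0 5 (N ∸ e)

  scale≤t : ∀ e → scale e ≤ t
  scale≤t e = ^-monoʳ-≤ 5 (m∸n≤m N e)

  colour : ℕ → Pair
  colour zero    true  = base
  colour zero    false = base + t
  colour (suc e)       = extend t (scale (suc e)) (colour e) (ℓ e)

  -- base = 3tN leaves room for N steps that each move down by at most 3t, so the subtraction in
  -- extendOrdered never truncates.
  Window : ℕ → ℕ → Set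
  Window e c = base ≤ c + 3 * t * e × c ≤ base + t + 3 * t * e

  Invariant : ℕ → Pair → Set
  Invariant e z = Spread t (scale e) (z true) (z false) × (∀ s → Window e (z s))

  invariant-zero : Invariant 0 (colour 0)
  invariant-zero =
    (subst (t ≤_) (≡.sym ∣base-base+t∣) ≤-refl ,
     subst (λ d → d + t ≤ 2 * t) (≡.sym ∣base-base+t∣) (≤-reflexive (cong (t +_) (≡.sym (+-identityʳ t))))) ,
    λ { true  → m≤m+n base _ , ≤-trans (m≤m+n base t) (m≤m+n _ _)
      ; false → ≤-trans (m≤m+n base t) (m≤m+n _ _) , m≤m+n _ _ }
    where
    ∣base-base+t∣ : ∣ base - base + t ∣ ≡ t
    ∣base-base+t∣ = ∣m-m+n∣≡n base t

  margin : ∀ {e c} → e < N → Window e c → t + 2 * scale (suc e) ≤ c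
  margin {e} {c} e<N (base≤c+3te , _) = begin
    t + 2 * scale (suc e)  ≤⟨ +-monoʳ-≤ t (*-monoʳ-≤ 2 (scale≤t (suc e))) ⟩
    3 * t                  ≤⟨ +-cancelʳ-≤ (3 * t * e) (3 * t) c 3t+3te≤c+3te ⟩
    c                      ∎
    where
    open ≤-Reasoning
    3t+3te≤c+3te : 3 * t + 3 * t * e ≤ c + 3 * t * e
    3t+3te≤c+3te = ≤-trans (≤-reflexive (≡.sym (*-suc (3 * t) e)))
                     (≤-trans (*-monoʳ-≤ (3 * t) e<N) base≤c+3te)

  preserved : ∀ {e z ℓ′ x} → e < N → Invariant e z → Extends t (scale (suc e)) z ℓ′ x →
    Invariant (suc e) x
  preserved {e} {z} {x = x} e<N (_ , window) ext =
    Extends.spread ext , λ s′ → lower s′ (Extends.above ext s′) , upper s′ (Extends.below ext s′)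
    where
    3t[1+e] : 3 * t * suc e ≡ 3 * t + 3 * t * e
    3t[1+e] = *-suc (3 * t) e

    lower : ∀ s′ → ∃[ s ] z s ≤ x s′ + 3 * t → base ≤ x s′ + 3 * t * suc e
    lower s′ (s , zs≤x+3t) = begin
      base                         ≤⟨ proj₁ (window s) ⟩
      z s + 3 * t * e              ≤⟨ +-monoˡ-≤ (3 * t * e) zs≤x+3t ⟩
      x s′ + 3 * t + 3 * t * e     ≡⟨ +-assoc (x s′) (3 * t) (3 * t * e) ⟩
      x s′ + (3 * t + 3 * t * e)   ≡⟨ cong (x s′ +_) 3t[1+e] ⟨
      x s′ + 3 * t * suc e         ∎
      where open ≤-Reasoning

    upper : ∀ s′ → ∃[ s ] x s′ ≤ z s + 3 * t → x s′ ≤ base + t + 3 * t * suc e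
    upper s′ (s , x≤zs+3t) = begin
      x s′                               ≤⟨ x≤zs+3t ⟩
      z s + 3 * t                        ≤⟨ +-monoˡ-≤ (3 * t) (proj₂ (window s)) ⟩
      base + t + 3 * t * e + 3 * t       ≡⟨ +-assoc (base + t) (3 * t * e) (3 * t) ⟩
      base + t + (3 * t * e + 3 * t)     ≡⟨ cong (base + t +_) (trans 3t[1+e] (+-comm (3 * t) (3 * t * e))) ⟨
      base + t + 3 * t * suc e           ∎
      where open ≤-Reasoning

  mutual
    invariant : ∀ e → e ≤ N → Invariant e (colour e)
    invariant zero    _   = invariant-zero
    invariant (suc e) e<N = preserved e<N (invariant e (<⇒≤ e<N)) (extends e e<N)

    extends : ∀ e → e < N → Extends t (scale (suc e)) (colour e) (ℓ e) (colour (suc e))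
    extends e e<N = extend-extends (ℓ e) (1≤scale (suc e))
      (subst (λ μ → Spread t μ (colour e true) (colour e false)) (scale-suc e<N) spread)
      (λ s → margin e<N (window s))
      where
      spread = proj₁ (invariant e (<⇒≤ e<N))
      window = proj₂ (invariant e (<⇒≤ e<N))

  colour-respects : ∀ e → e < N → ∀ s′ s →
    Respects t (ℓ e s′ s) ∣ colour (suc e) s′ - colour e s ∣
  colour-respects e e<N = Extends.respects (extends e e<N)

  colour<range : ∀ e s → e ≤ N → colour e s < range N
  colour<range e s e≤N =
    s≤s (≤-trans (proj₂ (proj₂ (invariant e e≤N) s)) (+-monoʳ-≤ (base + t) (*-monoʳ-≤ (3 * t) e≤N)))

-- Maps between finite sets

missed : ∀ {m n} (f : Fin m → Fin n) → m < n → ∃[ j ] ∀ u → f u ≢ j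
missed {m} {n} f m<n with all? (λ j → any? (λ u → f u ≟ᶠ j))
... | no ¬surjective with ¬∀⟶∃¬ n _ (λ j → any? (λ u → f u ≟ᶠ j)) ¬surjective
...   | j , ¬hit = j , λ u fu≡j → ¬hit (u , fu≡j)
missed {m} {n} f m<n | yes surjective with pigeonhole m<n (λ j → proj₁ (surjective j))
...   | i , j , i<j , same = ⊥-elim (<-irrefl (cong toℕ i≡j) i<j)
  where
  i≡j : i ≡ j
  i≡j = trans (≡.sym (proj₂ (surjective i))) (trans (cong f same) (proj₂ (surjective j)))

module _ {m n} (f : Fin m → Fin n) (f-injective : Injective _≡_ _≡_ f) (ν : Fin m → Fin m → Bool) where

  extendAlong : Fin n → Fin n → Bool
  extendAlong x y with any? (λ u → f u ≟ᶠ x) | any? (λ v → f v ≟ᶠ y)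
  ... | yes (u , _) | yes (v , _) = ν u v
  ... | _           | _           = true

  extendAlong-∘ : ∀ u v → extendAlong (f u) (f v) ≡ ν u v
  extendAlong-∘ u v with any? (λ w → f w ≟ᶠ f u) | any? (λ w → f w ≟ᶠ f v)
  ... | yes (u′ , fu′≡fu) | yes (v′ , fv′≡fv) = cong₂ ν (f-injective fu′≡fu) (f-injective fv′≡fv)
  ... | no ¬hit           | _                 = ⊥-elim (¬hit (u , refl))
  ... | yes _             | no ¬hit           = ⊥-elim (¬hit (v , refl))

-- The doubled cycle

≡ᵇ-refl : ∀ m → (m ≡ᵇ m) ≡ true
≡ᵇ-refl m = Equivalence.to T-≡ (≡⇒≡ᵇ m m refl)

-- At least three blocks, so that the wrap-around pair (k − 1, 0) is not also a pair (i, i + 1).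
module DoubledCycle (M : ℕ) where

  k : ℕ
  k = 3 + M

  Vertex : Set
  Vertex = Fin (k + k)

  side : Vertex → Bool
  side x = [ (λ _ → true) , (λ _ → false) ]′ (splitAt k x)

  block : Vertex → Fin k
  block x = [ id , id ]′ (splitAt k x)

  index : Vertex → ℕ
  index x = toℕ (block x)

  vertex : Bool → Fin k → Vertex
  vertex true  i = i ↑ˡ k
  vertex false i = k ↑ʳ i

  side-vertex : ∀ s i → side (vertex s i) ≡ s
  side-vertex true  i rewrite splitAt-↑ˡ k i k = refl
  side-vertex false i rewrite splitAt-↑ʳ k k i = refl

  block-vertex : ∀ s i → block (vertex s i) ≡ i
  block-vertex true  i rewrite splitAt-↑ˡ k i k = refl
  block-vertex false i rewrite splitAt-↑ʳ k k i = refl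

  index-vertex : ∀ s i → index (vertex s i) ≡ toℕ i
  index-vertex s i = cong toℕ (block-vertex s i)

  vertex-side-block : ∀ x → vertex (side x) (block x) ≡ x
  vertex-side-block x with splitAt k x in eq
  ... | inj₁ i = splitAt⁻¹-↑ˡ eq
  ... | inj₂ i = splitAt⁻¹-↑ʳ eq

  wraps : ℕ → ℕ → Bool
  wraps i j = (suc i ≡ᵇ k) ∧ (j ≡ᵇ 0)

  follows : ℕ → ℕ → Bool
  follows i j = (suc i ≡ᵇ j) ∨ wraps i j

  follows-irrefl : ∀ i → follows i i ≡ false
  follows-irrefl zero    = refl
  follows-irrefl (suc i) = cong₂ _∨_ (1+n≢ᵇn i) (∧-zeroʳ (suc (suc i) ≡ᵇ k))
    where
    1+n≢ᵇn : ∀ n → (suc n ≡ᵇ n) ≡ false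
    1+n≢ᵇn zero    = refl
    1+n≢ᵇn (suc n) = 1+n≢ᵇn n

  follows-cases : ∀ i j → follows i j ≡ true → j ≡ suc i ⊎ (suc i ≡ k × j ≡ 0)
  follows-cases i j h with Equivalence.to T-∨ (Equivalence.from T-≡ h)
  ... | inj₁ 1+i≡j = inj₁ (≡.sym (≡ᵇ⇒≡ (suc i) j 1+i≡j))
  ... | inj₂ wrap with Equivalence.to T-∧ wrap
  ...   | 1+i≡k , j≡0 = inj₂ (≡ᵇ⇒≡ (suc i) k 1+i≡k , ≡ᵇ⇒≡ j 0 j≡0)

  adjacent : Vertex → Vertex → Bool
  adjacent x y = follows (index x) (index y) ∨ follows (index y) (index x)

  graph : Graph
  graph = record
    { n     = k + k
    ; adj   = adjacent
    ; sym   = λ x y → ∨-comm (follows (index x) (index y)) _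
    ; irref = λ x → cong₂ _∨_ (follows-irrefl (index x)) (follows-irrefl (index x))
    }

  crossesWrap : Vertex → Vertex → Bool
  crossesWrap x y = wraps (index x) (index y) ∨ wraps (index y) (index x)

  -- Near between copies on the same side, except across the wrap-around, where the sides are swapped.
  twisted : Labeling graph
  twisted = record
    { near    = λ x y → not (crossesWrap x y xor (side x xor side y))
    ; nearSym = λ x y → cong₂ (λ a b → not (a xor b))
                  (∨-comm (wraps (index x) (index y)) _) (xor-comm (side x) (side y))
    }

  follows-either : ∀ i → follows (suc i) i ∨ follows i (suc i) ≡ true
  follows-either i = trans (cong (follows (suc i) i ∨_) (cong (_∨ wraps i (suc i)) (≡ᵇ-refl i))) (∨-zeroʳ _)

  wraps-neither : ∀ i → wraps (suc i) i ∨ wraps i (suc i) ≡ false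
  wraps-neither zero    = refl
  wraps-neither (suc i) = cong₂ _∨_ (∧-zeroʳ (suc (suc (suc i)) ≡ᵇ k)) (∧-zeroʳ (suc (suc i) ≡ᵇ k))

  wraps-last : wraps 0 (2 + M) ∨ wraps (2 + M) 0 ≡ true
  wraps-last = cong (_∧ true) (≡ᵇ-refl M)

  follows-last : follows 0 (2 + M) ∨ follows (2 + M) 0 ≡ true
  follows-last = cong (_∧ true) (≡ᵇ-refl M)

  adjacent-step : ∀ x y → suc (index y) ≡ index x → adjacent x y ≡ true
  adjacent-step x y e = subst (λ a → follows a (index y) ∨ follows (index y) a ≡ true) e (follows-either (index y))

  near-step : ∀ x y → suc (index y) ≡ index x → near twisted x y ≡ not (side x xor side y)
  near-step x y e = cong (λ c → not (c xor (side x xor side y)))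
    (subst (λ a → wraps a (index y) ∨ wraps (index y) a ≡ false) e (wraps-neither (index y)))

  adjacent-wrap : ∀ x y → index x ≡ 0 → index y ≡ 2 + M → adjacent x y ≡ true
  adjacent-wrap x y ex ey = subst₂ (λ a b → follows a b ∨ follows b a ≡ true) (≡.sym ex) (≡.sym ey) follows-last

  near-wrap : ∀ x y → index x ≡ 0 → index y ≡ 2 + M → near twisted x y ≡ side x xor side y
  near-wrap x y ex ey = trans (cong (λ c → not (c xor (side x xor side y)))
    (subst₂ (λ a b → wraps a b ∨ wraps b a ≡ true) (≡.sym ex) (≡.sym ey) wraps-last)) (not-involutive _)

  last : Fin k
  last = fromℕ< (n<1+n (2 + M))

  twisted-not-colourable : ∀ {r t} → ¬ ThresholdColoring r t graph twisted
  twisted-not-colourable {t = t} c = contradiction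
    where
    open ThresholdColoring c

    colour : Bool → Fin k → ℕ
    colour s i = col (vertex s i)

    module _ {i j : Fin k} (j≡1+i : toℕ j ≡ suc (toℕ i)) where

      consecutive : ∀ s′ s → suc (index (vertex s i)) ≡ index (vertex s′ j)
      consecutive s′ s = trans (cong suc (index-vertex s i)) (trans (≡.sym j≡1+i) (≡.sym (index-vertex s′ j)))

      label : ∀ s′ s → near twisted (vertex s′ j) (vertex s i) ≡ not (s′ xor s)
      label s′ s = trans (near-step (vertex s′ j) (vertex s i) (consecutive s′ s))
                         (cong₂ (λ a b → not (a xor b)) (side-vertex s′ j) (side-vertex s i))

      same-side : ∀ s → ∣ colour s j - colour s i ∣ ≤ t
      same-side s = nearOK _ _ (adjacent-step (vertex s j) (vertex s i) (consecutive s s))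
                              (trans (label s s) (cong not (xor-same s)))

      other-side : ∀ s → t < ∣ colour (not s) j - colour s i ∣
      other-side s = farOK _ _ (adjacent-step (vertex (not s) j) (vertex s i) (consecutive (not s) s))
                              (trans (label (not s) s) (not-xor s))
        where
        not-xor : ∀ s → not (not s xor s) ≡ false
        not-xor true  = refl
        not-xor false = refl

      keeps-order : ∀ s → colour s i < colour (not s) i → colour s j < colour (not s) j
      keeps-order s lt = order-transfer lt (same-side s) (same-side (not s)) (other-side s)

    keeps-order-to : ∀ s → colour s Fin.zero < colour (not s) Fin.zero →
      ∀ m (m<k : m < k) → colour s (fromℕ< m<k) < colour (not s) (fromℕ< m<k)
    keeps-order-to s lt zero    _   = lt
    keeps-order-to s lt (suc m) m<k = keeps-order step s (keeps-order-to s lt m (<-trans (n<1+n m) m<k))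
      where
      step : toℕ (fromℕ< m<k) ≡ suc (toℕ (fromℕ< (<-trans (n<1+n m) m<k)))
      step = trans (toℕ-fromℕ< m<k) (cong suc (≡.sym (toℕ-fromℕ< _)))

    module _ (s′ s : Bool) where

      index-last : index (vertex s last) ≡ 2 + M
      index-last = trans (index-vertex s last) (toℕ-fromℕ< (n<1+n (2 + M)))

      wrapEdge : adjacent (vertex s′ Fin.zero) (vertex s last) ≡ true
      wrapEdge = adjacent-wrap (vertex s′ Fin.zero) (vertex s last) (index-vertex s′ Fin.zero) index-last

      wrapLabel : near twisted (vertex s′ Fin.zero) (vertex s last) ≡ s′ xor s
      wrapLabel = trans (near-wrap (vertex s′ Fin.zero) (vertex s last) (index-vertex s′ Fin.zero) index-last)
                        (cong₂ _xor_ (side-vertex s′ Fin.zero) (side-vertex s last))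

    reverses-order : ∀ s → colour s last < colour (not s) last → colour (not s) Fin.zero < colour s Fin.zero
    reverses-order s lt = order-transfer lt
      (nearOK _ _ (wrapEdge (not s) s) (trans (wrapLabel (not s) s) (not-xor s)))
      (nearOK _ _ (wrapEdge s (not s)) (trans (wrapLabel s (not s)) (xor-not s)))
      (farOK _ _ (wrapEdge s s) (trans (wrapLabel s s) (xor-same s)))
      where
      not-xor : ∀ s → not s xor s ≡ true
      not-xor true  = refl
      not-xor false = refl
      xor-not : ∀ s → s xor not s ≡ true
      xor-not true  = refl
      xor-not false = refl

    around : ∀ s → colour s Fin.zero < colour (not s) Fin.zero → ⊥
    around s lt = <-asym lt (reverses-order s (keeps-order-to s lt (2 + M) (n<1+n (2 + M))))

    contradiction : ⊥
    contradiction with <-cmp (colour true Fin.zero) (colour false Fin.zero)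
    ... | tri< lt _ _ = around true lt
    ... | tri> _ _ gt = around false gt
    ... | tri≈ _ eq _ = <⇒≱ (other-side {j = Fin.suc Fin.zero} refl true)
                          (subst (λ c → ∣ colour false (Fin.suc Fin.zero) - c ∣ ≤ t) (≡.sym eq)
                            (same-side refl false))

  -- Cutting the cycle at a missing block leaves the path missing + 1, …, k − 1, 0, …, missing − 1,
  -- whose blocks sit at positions missing + 1, …, 2k − 1 (reduced modulo k to get the block back).
  module AvoidingBlock (missing : Fin k) where

    position : ℕ → ℕ
    position i with toℕ missing <? i
    ... | yes _ = i
    ... | no  _ = i + k

    position-follows : ∀ {i j} → follows i j ≡ true → i ≢ toℕ missing → j ≢ toℕ missing →
      position j ≡ suc (position i)
    position-follows {i} {j} h i≢ j≢ with follows-cases i j h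
    ... | inj₁ refl with toℕ missing <? i | toℕ missing <? suc i
    ...   | yes _   | yes _     = refl
    ...   | no  _   | no  _     = refl
    ...   | yes m<i | no  m≮1+i = ⊥-elim (m≮1+i (m<n⇒m<1+n m<i))
    ...   | no  m≮i | yes m<1+i = ⊥-elim (i≢ (≤-antisym (≮⇒≥ m≮i) (s≤s⁻¹ m<1+i)))
    position-follows {i} h i≢ j≢ | inj₂ (1+i≡k , refl) with toℕ missing <? i
    ... | yes _   = ≡.sym 1+i≡k
    ... | no  m≮i = ⊥-elim (i≢ (≤-antisym (≮⇒≥ m≮i)
                      (s≤s⁻¹ (subst (toℕ missing <_) (≡.sym 1+i≡k) (toℕ<n missing)))))

    position< : ∀ i → i < k → position i < k + k
    position< i i<k with toℕ missing <? i
    ... | yes _ = ≤-trans i<k (m≤m+n k k)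
    ... | no  _ = +-monoˡ-< k i<k

    blockAt : ℕ → Fin k
    blockAt e = fromℕ< (m%n<n e k)

    blockAt-position : ∀ i → i < k → toℕ (blockAt (position i)) ≡ i
    blockAt-position i i<k with toℕ missing <? i
    ... | yes _ = trans (toℕ-fromℕ< _) (m<n⇒m%n≡m i<k)
    ... | no  _ = trans (toℕ-fromℕ< _) (trans ([m+n]%n≡m%n i k) (m<n⇒m%n≡m i<k))

    module _ (label : Vertex → Vertex → Bool) where

      pathLabel : ℕ → Bool → Bool → Bool
      pathLabel e s′ s = label (vertex s′ (blockAt (suc e))) (vertex s (blockAt e))

      open PathColouring (k + k) pathLabel

      colouring : Vertex → ℕ
      colouring x = colour (position (index x)) (side x)

      colouring<range : ∀ x → colouring x < range (k + k)
      colouring<range x = colour<range _ (side x) (<⇒≤ (position< (index x) (toℕ<n (block x))))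

      colouring-respects : ∀ x y → follows (index x) (index y) ≡ true →
        index x ≢ toℕ missing → index y ≢ toℕ missing →
        Respects (threshold (k + k)) (label y x) ∣ colouring y - colouring x ∣
      colouring-respects x y h x≢ y≢ =
        subst₂ (λ b c → Respects (threshold (k + k)) b ∣ colour c (side y) - colouring x ∣)
          (cong₂ label (at y (≡.sym step)) (at x refl)) (≡.sym step)
          (colour-respects e (position< (index x) (toℕ<n (block x))) (side y) (side x))
        where
        e = position (index x)
        step : position (index y) ≡ suc e
        step = position-follows h x≢ y≢
        at : ∀ z {e′} → e′ ≡ position (index z) → vertex (side z) (blockAt e′) ≡ z
        at z refl = trans (cong (vertex (side z)) (toℕ-injective (blockAt-position (index z) (toℕ<n (block z)))))
                          (vertex-side-block z)

  small-subgraph-colourable : ∀ H → n H < k → SubgraphOf H graph → TotalThresholdColorable H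
  small-subgraph-colourable H n<k (f , f-injective , f-edge) =
    range (k + k) , threshold (k + k) , threshold≤range (k + k) , colourFor
    where
    gap = missed (block ∘ f) n<k
    open AvoidingBlock (proj₁ gap)

    avoids : ∀ u → index (f u) ≢ toℕ (proj₁ gap)
    avoids u e = proj₂ gap u (toℕ-injective e)

    colourFor : (L : Labeling H) → ThresholdColoring (range (k + k)) (threshold (k + k)) H L
    colourFor L = record
      { col    = c ∘ f
      ; col<r  = colouring<range label ∘ f
      ; nearOK = λ u v uv nearUV → subst (λ b → Respects t b (d u v)) nearUV (respects u v (f-edge u v uv))
      ; farOK  = λ u v uv farUV → subst (λ b → Respects t b (d u v)) farUV (respects u v (f-edge u v uv))
      }
      where
      label = extendAlong f f-injective (near L)
      c = colouring label
      t = threshold (k + k)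

      d : Fin (n H) → Fin (n H) → ℕ
      d u v = ∣ c (f u) - c (f v) ∣

      respects : ∀ u v → adjacent (f u) (f v) ≡ true → Respects t (near L u v) (d u v)
      respects u v uv with follows (index (f u)) (index (f v)) in forward
      ... | true  = subst₂ (Respects t) (trans (extendAlong-∘ f f-injective (near L) v u) (nearSym L v u))
                      (∣-∣-comm (c (f v)) (c (f u)))
                      (colouring-respects label (f u) (f v) forward (avoids u) (avoids v))
      ... | false = subst (λ b → Respects t b (d u v)) (extendAlong-∘ f f-injective (near L) u v)
                      (colouring-respects label (f v) (f u) uv (avoids v) (avoids u))

-- No finite family of forbidden subgraphs

maxOrder : List Graph → ℕ
maxOrder 𝔉 = max 0 (map n 𝔉)

order≤maxOrder : ∀ 𝔉 → All (λ H → n H ≤ maxOrder 𝔉) 𝔉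
order≤maxOrder 𝔉 = map⁻ (xs≤max 0 (map n 𝔉))

subgraph-refl : ∀ H → SubgraphOf H H
subgraph-refl H = id , id , λ _ _ → id

induced-refl : ∀ H → InducedSubgraphOf H H
induced-refl H = id , id , λ _ _ → refl

induced⇒subgraph : ∀ H G → InducedSubgraphOf H G → SubgraphOf H G
induced⇒subgraph H G (f , f-injective , f-adj) =
  f , f-injective , λ u v uv → trans {j = adj H u v} (f-adj u v) uv

module _ (_⊑_ : Graph → Graph → Set) (⊑-refl : ∀ H → H ⊑ H)
         (⊑⇒subgraph : ∀ H G → H ⊑ G → SubgraphOf H G) where

  no-finite-characterisation : ∀ 𝔉 →
    ¬ (∀ G → (TotalThresholdColorable G → ¬ Any (_⊑ G) 𝔉) × (¬ Any (_⊑ G) 𝔉 → TotalThresholdColorable G))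
  no-finite-characterisation 𝔉 char = cycle-contains-member member-not-in-cycle
    where
    open DoubledCycle (maxOrder 𝔉)

    cycle-contains-member : ¬ ¬ Any (_⊑ graph) 𝔉
    cycle-contains-member none with proj₂ (char graph) none
    ... | _ , _ , _ , colouring = twisted-not-colourable (colouring twisted)

    member-not-in-cycle : ¬ Any (_⊑ graph) 𝔉
    member-not-in-cycle found =
      proj₁ (char H) H-colourable (Any.map (λ { refl → ⊑-refl H }) (∈-lookup (Any.index found)))
      where
      H = Any.lookup found
      H-colourable : TotalThresholdColorable H
      H-colourable with lookupAny (order≤maxOrder 𝔉) found
      ... | small , H⊑graph =
        small-subgraph-colourable H (s≤s (≤-trans small (m≤n+m _ 2))) (⊑⇒subgraph H graph H⊑graph)

corollary1 : (¬ ∃ λ (𝔉 : List Graph) → ForbiddenSubgraphChar 𝔉)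
    × (¬ ∃ λ (𝔉 : List Graph) → ForbiddenInducedSubgraphChar 𝔉)
corollary1 =
  (λ (𝔉 , char) → no-finite-characterisation SubgraphOf subgraph-refl (λ _ _ → id) 𝔉 char) ,
  (λ (𝔉 , char) → no-finite-characterisation InducedSubgraphOf induced-refl induced⇒subgraph 𝔉 char)
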